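{- Let $\mathcal{C}$ be a switching class of $3$-tournaments on a finite set $V$ and let $\{g_1,\dots,g_k\}$ be a complete set of representatives of the isomorphism classes of elements of $\mathcal{C}$. Then there is a one-to-one correspondence between the left cosets $\operatorname{Aut}(\mathcal{C})/\operatorname{Aut}(g_1)$ and $\{g\in\mathcal{C}\mid g\cong g_1\}$, and $$\sum_{i=1}^k\frac{1}{|\operatorname{Aut}(g_i)|}=\frac{2^{\binom{|V|-1}{2}}}{|\operatorname{Aut}(\mathcal{C})|}.$$
   Context: A $3$-tournament on $V$ is an alternating function $g$ from ordered triples of distinct elements of $V$ to $\{\pm1\}$. A two-graph on $V$ is a set $\mathcal{X}$ of $3$-subsets such that every $4$-subset contains zero, two or four members of $\mathcal{X}$. $g^{\mathcal{X}}(x,y,z)=g(x,y,z)$ if $\{x,y,z\}\in\mathcal{X}$ and $-g(x,y,z)$ otherwise; $g_1,g_2$ are switching equivalent if $g_2=g_1^{\mathcal{X}}$ for some two-graph $\mathcal{X}$, and a switching class is an equivalence class of this relation. $\mathcal{H}(g)$ is the $4$-graph of $4$-sets $\{x,y,z,w\}$ with $g(x,y,z)g(y,x,w)g(z,y,w)g(x,z,w)=+1$; it is constant on switching classes, and $\operatorname{Aut}(\mathcal{C}):=\operatorname{Aut}(\mathcal{H}(g))$ for $g\in\mathcal{C}$ (permutations of $V$ mapping edges of $\mathcal{H}(g)$ to edges). A permutation $\sigma$ acts on $3$-tournaments by $(\sigma g)(\sigma x,\sigma y,\sigma z)=g(x,y,z)$; $g\cong g'$ if $g'=\sigma g$ for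 some $\sigma$, and $\operatorname{Aut}(g)=\{\sigma:\sigma g=g\}$. -}

module Defs where

open import Data.Nat using (ℕ; zero; suc)
open import Data.Fin using (Fin; zero; suc)
open import Data.Bool using (Bool; true; false; if_then_else_)
open import Data.Sign using (Sign; opposite) renaming (_*_ to _*ₛ_)
import Data.Sign as Sgn
open import Data.Product using (Σ; ∃; _×_)
open import Data.Sum using (_⊎_)
open import Data.Integer using (+_)
open import Data.Rational using (ℚ; 0ℚ; _/_) renaming (_+_ to _+ℚ_)
open import Data.Fin.Permutation using (Permutation′; _⟨$⟩ʳ_; _⟨$⟩ˡ_; _∘ₚ_; flip)
open import Relation.Binary.PropositionalEquality using (_≡_; _≢_)

-- Raw ternary sign-valued functions on V (values on triples with
-- repeated entries are irrelevant; see _≈_ below).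
T3 : ℕ → Set
T3 n = Fin n → Fin n → Fin n → Sign

Distinct3 : ∀ {n} → Fin n → Fin n → Fin n → Set
Distinct3 x y z = x ≢ y × y ≢ z × x ≢ z

Distinct4 : ∀ {n} → Fin n → Fin n → Fin n → Fin n → Set
Distinct4 x y z w = x ≢ y × x ≢ z × x ≢ w × y ≢ z × y ≢ w × z ≢ w

-- A 3-tournament: alternating on ordered triples of distinct elements
-- (changes sign under each transposition, hence g ∘ π = sgn π · g).
Is3Tournament : ∀ {n} → T3 n → Set
Is3Tournament g = ∀ x y z → Distinct3 x y z →
  (g y x z ≡ opposite (g x y z)) × (g x z y ≡ opposite (g x y z))

_≈_ : ∀ {n} → T3 n → T3 n → Set
g ≈ h = ∀ x y z → Distinct3 x y z → g x y z ≡ h x y z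

-- A set of 3-subsets, given by its indicator on ordered triples,
-- invariant under reordering of distinct triples.
Sym3 : ∀ {n} → (Fin n → Fin n → Fin n → Bool) → Set
Sym3 X = ∀ x y z → Distinct3 x y z → (X y x z ≡ X x y z) × (X x z y ≡ X x y z)

b2n : Bool → ℕ
b2n true = 1
b2n false = 0

IsTwoGraph : ∀ {n} → (Fin n → Fin n → Fin n → Bool) → Set
IsTwoGraph X = Sym3 X × (∀ x y z w → Distinct4 x y z w →
  let c = b2n (X x y z) Data.Nat.+ b2n (X x y w) Data.Nat.+ b2n (X x z w) Data.Nat.+ b2n (X y z w)
  in (c ≡ 0) ⊎ (c ≡ 2) ⊎ (c ≡ 4))

switch : ∀ {n} → T3 n → (Fin n → Fin n → Fin n → Bool) → T3 n
switch g X x y z = if X x y z then g x y z else opposite (g x y z)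

SwitchEq : ∀ {n} → T3 n → T3 n → Set
SwitchEq {n} g₁ g₂ = Σ (Fin n → Fin n → Fin n → Bool) λ X → IsTwoGraph X × (g₂ ≈ switch g₁ X)

InClass : ∀ {n} → T3 n → T3 n → Set
InClass g₀ g = Is3Tournament g × SwitchEq g₀ g

H : ∀ {n} → T3 n → Fin n → Fin n → Fin n → Fin n → Set
H g x y z w = (g x y z *ₛ g y x w *ₛ g z y w *ₛ g x z w) ≡ Sgn.+

InAutH : ∀ {n} → T3 n → Permutation′ n → Set
InAutH g σ = ∀ x y z w → Distinct4 x y z w → H g x y z w →
  H g (σ ⟨$⟩ʳ x) (σ ⟨$⟩ʳ y) (σ ⟨$⟩ʳ z) (σ ⟨$⟩ʳ w)

-- Action: (σ g)(σ x, σ y, σ z) = g(x, y, z).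
act : ∀ {n} → Permutation′ n → T3 n → T3 n
act σ g a b c = g (σ ⟨$⟩ˡ a) (σ ⟨$⟩ˡ b) (σ ⟨$⟩ˡ c)

Iso : ∀ {n} → T3 n → T3 n → Set
Iso {n} g g' = Σ (Permutation′ n) λ σ → g' ≈ act σ g

InAut : ∀ {n} → T3 n → Permutation′ n → Set
InAut g σ = act σ g ≈ g

-- σ⁻¹ τ  (the map x ↦ σ⁻¹(τ x); note _∘ₚ_ is diagrammatic order)
_⁻¹·_ : ∀ {n} → Permutation′ n → Permutation′ n → Permutation′ n
σ ⁻¹· τ = τ ∘ₚ flip σ

_≈ₚ_ : ∀ {n} → Permutation′ n → Permutation′ n → Set
σ ≈ₚ τ = ∀ x → σ ⟨$⟩ʳ x ≡ τ ⟨$⟩ʳ x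

HasCard : ∀ {n} → (Permutation′ n → Set) → ℕ → Set
HasCard {n} P m = Σ (Fin m → Permutation′ n) λ e →
  (∀ i → P (e i)) × (∀ i j → e i ≈ₚ e j → i ≡ j) × (∀ σ → P σ → ∃ λ i → σ ≈ₚ e i)

-- 1/m as a rational (m = 0 never occurs for group orders; set to 0).
recipℕ : ℕ → ℚ
recipℕ zero = 0ℚ
recipℕ (suc m) = (+ 1) / suc m

sumℚ : ∀ {k} → (Fin k → ℚ) → ℚ
sumℚ {zero} f = 0ℚ
sumℚ {suc k} f = f zero +ℚ sumℚ (λ i → f (suc i))

-- The 4-graph H(g) is a complete invariant of switching classes: g is switching equivalent
-- to g₀ iff g = s ·₃ g₀ for a symmetric sign pattern s with trivial coboundary, iff H(g) = H(g₀).
-- Such patterns are determined by their values on the triangles through one fixed vertex, so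
-- they correspond to the signed graphs on the other n - 1 vertices and the class has
-- 2^C(n-1,2) elements. Hence Aut(H(g₀)) acts on the class; its orbits are the isomorphism
-- classes, and σ ↦ σ gᵢ identifies the cosets of Aut(gᵢ) with the orbit of gᵢ. Summing
-- |orbit of gᵢ| = |Aut(H(g₀))| / |Aut(gᵢ)| over the representatives gives the mass formula.

module Submission where

open import Level using (0ℓ)
open import Data.Nat as ℕ using (ℕ; zero; suc; _+_; _*_; _^_; _∸_)
import Data.Nat.Properties as ℕ
open import Data.Nat.Combinatorics using (_C_; nC1≡n; nCk+nC[k+1]≡[n+1]C[k+1])
open import Data.Fin as Fin using (Fin; zero; suc; combine; remQuot; punchOut)
import Data.Fin.Properties as Fin
open import Data.Fin.Permutation using (Permutation′; _⟨$⟩ʳ_; _⟨$⟩ˡ_; _∘ₚ_; flip; inverseˡ; inverseʳ)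
  renaming (id to idₚ)
open import Data.Bool using (Bool; true; false; T)
open import Data.Sign as Sign using (Sign; opposite) renaming (_*_ to _·_)
import Data.Sign.Properties as Sign
open import Data.Integer as ℤ using (+_)
import Data.Integer.Properties as ℤ
open import Data.Rational using (ℚ; _/_; fromℚᵘ) renaming (_+_ to _+ℚ_; _*_ to _*ℚ_)
import Data.Rational.Properties as ℚ
open import Data.Rational.Unnormalised as ℚᵘ using (mkℚᵘ; *≡*)
import Data.Rational.Unnormalised.Properties as ℚᵘ
open import Data.Product using (Σ; ∃; _×_; _,_; proj₁; proj₂)
open import Data.Product.Relation.Binary.Pointwise.NonDependent using (_×ₛ_)
open import Data.Sum using (_⊎_; inj₁; inj₂)
open import Data.Empty using (⊥-elim; ⊥-elim-irr)
open import Data.Vec.Functional using (_∷_; head; tail)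
import Data.Vec.Functional.Relation.Binary.Equality.Setoid as VecEq
open import Relation.Binary.Bundles using (Setoid)
open import Relation.Binary.Definitions using (tri<; tri≈; tri>)
import Relation.Binary.Construct.On as On
open import Relation.Binary.PropositionalEquality as ≡
  using (_≡_; _≢_; cong; cong₂; subst; ≢-sym)
open import Relation.Nullary using (Dec; yes; no; ¬_)
open import Relation.Nullary.Decidable using (⌊_⌋; toWitness; fromWitness; ¬?; _×-dec_)
open import Algebra.Properties.CommutativeMonoid.Sum ℕ.+-0-commutativeMonoid
  using (sum; ∑-comm; sum-cong-≗; sum-replicate-zero)
open import Algebra.Solver.CommutativeMonoid Sign.*-commutativeMonoid using (solve; _⊕_; _⊜_)
open import Function.Base using (_∘_)
open import Function.Bundles using (_⇔_; mk⇔; Equivalence)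
open import Function.Definitions using (Injective)

open import Defs hiding (_≈_)

private variable
  m n N k : ℕ

-- Finite setoids

Fin-injective⇒surjective : (f : Fin m → Fin m) → Injective _≡_ _≡_ f → ∀ y → ∃ λ x → f x ≡ y
Fin-injective⇒surjective {suc m} f f-injective y with Fin.any? (λ x → f x Fin.≟ y)
... | yes hit = hit
... | no miss = ⊥-elim (Fin.<⇒notInjective (ℕ.n<1+n m) f-punched-injective)
  where
  y≢f : ∀ x → y ≢ f x
  y≢f x y≡fx = miss (x , ≡.sym y≡fx)
  f-punched-injective : Injective _≡_ _≡_ (λ x → punchOut (y≢f x))
  f-punched-injective p = f-injective (Fin.punchOut-injective (y≢f _) (y≢f _) p)

record Enumeration (S : Setoid 0ℓ 0ℓ) (m : ℕ) : Set where
  open Setoid S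
  field
    enum           : Fin m → Carrier
    enum-injective : ∀ {i j} → enum i ≈ enum j → i ≡ j
    index          : Carrier → Fin m
    enum-index     : ∀ x → x ≈ enum (index x)

  index-cong : ∀ {x y} → x ≈ y → index x ≡ index y
  index-cong {x} {y} x≈y =
    enum-injective (trans (sym (enum-index x)) (trans x≈y (enum-index y)))

open Enumeration

subsetoid : (S : Setoid 0ℓ 0ℓ) → (Setoid.Carrier S → Set) → Setoid 0ℓ 0ℓ
subsetoid S P = On.setoid {B = Σ (Setoid.Carrier S) P} S proj₁

module _ {S : Setoid 0ℓ 0ℓ} where
  open Setoid S

  enumeration-size-unique : ∀ {m m′} → Enumeration S m → Enumeration S m′ → m ≡ m′
  enumeration-size-unique E E′ =
    Fin.cantor-schröder-bernstein (reindex-injective E E′) (reindex-injective E′ E)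
    where
    reindex-injective : ∀ {m m′} (E : Enumeration S m) (E′ : Enumeration S m′) →
      Injective _≡_ _≡_ (λ i → index E′ (enum E i))
    reindex-injective E E′ {i} {j} p = enum-injective E
      (trans (enum-index E′ (enum E i))
        (trans (reflexive (cong (enum E′) p)) (sym (enum-index E′ (enum E j)))))

  injective⇒surjective : Enumeration S m → (F : Carrier → Carrier) →
    (∀ {x y} → x ≈ y → F x ≈ F y) → (∀ {x y} → F x ≈ F y → x ≈ y) →
    ∀ y → ∃ λ x → F x ≈ y
  injective⇒surjective E F F-cong F-injective y =
    let (i , ψi≡y) = Fin-injective⇒surjective ψ ψ-injective (index E y)
    in enum E i , trans (enum-index E _) (trans (reflexive (cong (enum E) ψi≡y)) (sym (enum-index E y)))
    where
    ψ : Fin _ → Fin _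
    ψ i = index E (F (enum E i))
    ψ-injective : Injective _≡_ _≡_ ψ
    ψ-injective p = enum-injective E (F-injective
      (trans (enum-index E _) (trans (reflexive (cong (enum E) p)) (sym (enum-index E _)))))

fin-enumeration : ∀ n → Enumeration (≡.setoid (Fin n)) n
fin-enumeration n = record
  { enum = λ i → i ; enum-injective = λ p → p ; index = λ i → i ; enum-index = λ _ → ≡.refl }

module _ {A B : Setoid 0ℓ 0ℓ} where
  private
    module A = Setoid A
    module B = Setoid B

  transport : (F : A.Carrier → B.Carrier) (G : B.Carrier → A.Carrier) →
    (∀ {x y} → x A.≈ y → F x B.≈ F y) → (∀ {x y} → F x B.≈ F y → x A.≈ y) →
    (∀ y → y B.≈ F (G y)) → Enumeration A m → Enumeration B m
  transport F G F-cong F-injective F∘G E = record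
    { enum           = λ i → F (enum E i)
    ; enum-injective = λ p → enum-injective E (F-injective p)
    ; index          = λ y → index E (G y)
    ; enum-index     = λ y → B.trans (F∘G y) (F-cong (enum-index E (G y)))
    }

  _×-enumeration_ : ∀ {a b} → Enumeration A a → Enumeration B b → Enumeration (A ×ₛ B) (a * b)
  _×-enumeration_ {a} {b} E E′ = record
    { enum           = λ k → enum E (proj₁ (remQuot {a} b k)) , enum E′ (proj₂ (remQuot {a} b k))
    ; enum-injective = λ {k} {k′} (p , q) → ≡.trans (≡.sym (Fin.combine-remQuot {a} b k))
        (≡.trans (cong₂ combine (enum-injective E p) (enum-injective E′ q)) (Fin.combine-remQuot {a} b k′))
    ; index          = λ (x , y) → combine (index E x) (index E′ y)
    ; enum-index     = λ (x , y) →
        subst (λ (i , j) → x A.≈ enum E i × y B.≈ enum E′ j)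
          (≡.sym (Fin.remQuot-combine {a} {b} (index E x) (index E′ y))) (enum-index E x , enum-index E′ y)
    }

module _ (S : Setoid 0ℓ 0ℓ) where
  open Setoid S
  open VecEq S using (≋-setoid)

  vector-enumeration : ∀ {a} → Enumeration S a → ∀ m → Enumeration (≋-setoid m) (a ^ m)
  vector-enumeration E zero = record
    { enum = λ _ () ; enum-injective = λ { {zero} {zero} _ → ≡.refl }
    ; index = λ _ → zero ; enum-index = λ _ () }
  vector-enumeration E (suc m) =
    transport {A = S ×ₛ ≋-setoid m} (λ (x , v) → x ∷ v) (λ v → head v , tail v)
      (λ { (p , q) zero → p ; (p , q) (suc i) → q i })
      (λ p → p zero , λ i → p (suc i))
      (λ v → λ { zero → refl ; (suc i) → refl })
      (E ×-enumeration vector-enumeration E m)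

  -- The label of the edge {x, y} is stored at x < y.
  Graph : ℕ → Set
  Graph m = (x y : Fin m) → .(x Fin.< y) → Carrier

  graph-setoid : ℕ → Setoid 0ℓ 0ℓ
  graph-setoid m = record
    { Carrier = Graph m
    ; _≈_ = λ G G′ → ∀ x y .(x<y : x Fin.< y) → G x y x<y ≈ G′ x y x<y
    ; isEquivalence = record
      { refl = λ _ _ _ → refl
      ; sym = λ p x y x<y → sym (p x y x<y)
      ; trans = λ p q x y x<y → trans (p x y x<y) (q x y x<y) } }

  private
    extend : Graph m → (Fin m → Carrier) → Graph (suc m)
    extend G r zero    (suc y) _   = r y
    extend G r (suc x) (suc y) x<y = G x y (ℕ.s<s⁻¹ x<y)
    extend G r _       zero    x<0 = ⊥-elim-irr (ℕ.n≮0 x<0)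

  graph-enumeration : ∀ {a} → Enumeration S a → ∀ m → Enumeration (graph-setoid m) (a ^ (m C 2))
  graph-enumeration E zero = record
    { enum = λ _ () ; enum-injective = λ { {zero} {zero} _ → ≡.refl }
    ; index = λ _ → zero ; enum-index = λ _ () }
  graph-enumeration {a} E (suc m) = subst (Enumeration (graph-setoid (suc m))) (size m)
    (transport {A = graph-setoid m ×ₛ VecEq.≋-setoid S m} (λ (G , r) → extend G r)
      (λ H → (λ x y x<y → H (suc x) (suc y) (ℕ.s<s x<y)) , (λ y → H zero (suc y) ℕ.z<s))
      (λ { (p , q) zero (suc y) _ → q y ; (p , q) (suc x) (suc y) x<y → p x y (ℕ.s<s⁻¹ x<y) })
      (λ p → (λ x y x<y → p (suc x) (suc y) (ℕ.s<s x<y)) , λ y → p zero (suc y) ℕ.z<s)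
      (λ { H zero (suc y) _ → refl ; H (suc x) (suc y) _ → refl })
      (graph-enumeration E m ×-enumeration vector-enumeration E m))
    where
    size : ∀ m → a ^ (m C 2) * a ^ m ≡ a ^ (suc m C 2)
    size m = ≡.trans (≡.sym (ℕ.^-distribˡ-+-* a (m C 2) m)) (cong (a ^_)
      (≡.trans (ℕ.+-comm (m C 2) m)
        (≡.trans (cong (_+ m C 2) (≡.sym (nC1≡n m))) (nCk+nC[k+1]≡[n+1]C[k+1] m 1))))

count : (Fin N → Bool) → ℕ
count b = sum (λ j → b2n (b j))

sum-const : ∀ o a → sum {o} (λ _ → a) ≡ o * a
sum-const zero    a = ≡.refl
sum-const (suc o) a = cong (λ s → a + s) (sum-const o a)

sum-indicator : (c : Fin k) → sum (λ i → b2n ⌊ c Fin.≟ i ⌋) ≡ 1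
sum-indicator {suc k} zero    = cong suc (sum-replicate-zero k)
sum-indicator {suc k} (suc c) =
  ≡.trans (sum-cong-≗ (λ i → cong b2n (does-suc≟suc c i))) (sum-indicator c)
  where
  does-suc≟suc : (c i : Fin k) → ⌊ suc c Fin.≟ suc i ⌋ ≡ ⌊ c Fin.≟ i ⌋
  does-suc≟suc c i with c Fin.≟ i
  ... | yes _ = ≡.refl
  ... | no _  = ≡.refl

trues-enumeration : (b : Fin N → Bool) → Enumeration (subsetoid (≡.setoid (Fin N)) (λ j → T (b j))) (count b)
trues-enumeration {zero}  b = record
  { enum = λ () ; enum-injective = λ { {()} } ; index = λ () ; enum-index = λ () }
trues-enumeration {suc N} b with b zero in b₀ | trues-enumeration (λ j → b (suc j))
... | true  | E = record
  { enum           = λ { zero    → zero , subst T (≡.sym b₀) _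
                       ; (suc i) → suc (proj₁ (enum E i)) , proj₂ (enum E i) }
  ; enum-injective = λ { {zero} {zero} _ → ≡.refl
                       ; {suc i} {suc j} p → cong suc (enum-injective E (Fin.suc-injective p)) }
  ; index          = λ { (zero , _) → zero ; (suc j , bj) → suc (index E (j , bj)) }
  ; enum-index     = λ { (zero , _) → ≡.refl ; (suc j , bj) → cong suc (enum-index E (j , bj)) }
  }
... | false | E = record
  { enum           = λ i → suc (proj₁ (enum E i)) , proj₂ (enum E i)
  ; enum-injective = λ p → enum-injective E (Fin.suc-injective p)
  ; index          = λ { (zero , b0) → ⊥-elim (subst T b₀ b0) ; (suc j , bj) → index E (j , bj) }
  ; enum-index     = λ { (zero , b0) → ⊥-elim (subst T b₀ b0) ; (suc j , bj) → cong suc (enum-index E (j , bj)) }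
  }

module _ {S : Setoid 0ℓ 0ℓ} where
  open Setoid S

  filter-enumeration : (E : Enumeration S N) (P : Carrier → Set) (P? : ∀ x → Dec (P x)) →
    (∀ {x y} → x ≈ y → P x → P y) →
    Enumeration (subsetoid S P) (count (λ j → ⌊ P? (enum E j) ⌋))
  filter-enumeration E P P? P-resp =
    transport {A = subsetoid (≡.setoid (Fin _)) (λ j → T ⌊ P? (enum E j) ⌋)}
      (λ (j , pj) → enum E j , toWitness pj)
      (λ (x , px) → index E x , fromWitness (P-resp (enum-index E x) px))
      (λ { ≡.refl → refl }) (enum-injective E) (λ (x , _) → enum-index E x)
      (trues-enumeration _)

  fibre-sizes : (E : Enumeration S N) (f : Carrier → Fin k) → (∀ {x y} → x ≈ y → f x ≡ f y) →
    (m : Fin k → ℕ) → (∀ i → Enumeration (subsetoid S (λ x → f x ≡ i)) (m i)) → N ≡ sum m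
  fibre-sizes {N} {k} E f f-cong m fibre = begin
    N
      ≡⟨ ≡.sym (≡.trans (sum-const N 1) (ℕ.*-identityʳ N)) ⟩
    sum {N} (λ j → 1)
      ≡⟨ sum-cong-≗ (λ j → ≡.sym (sum-indicator (f (enum E j)))) ⟩
    sum (λ j → sum (λ i → b2n ⌊ f (enum E j) Fin.≟ i ⌋))
      ≡⟨ ∑-comm {N} {k} _ ⟩
    sum (λ i → count (λ j → ⌊ f (enum E j) Fin.≟ i ⌋))
      ≡⟨ sum-cong-≗ (λ i → enumeration-size-unique (fibre-by-filter i) (fibre i)) ⟩
    sum m ∎
    where
    open ≡.≡-Reasoning
    fibre-by-filter : ∀ i → Enumeration (subsetoid S (λ x → f x ≡ i)) (count (λ j → ⌊ f (enum E j) Fin.≟ i ⌋))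
    fibre-by-filter i =
      filter-enumeration E (λ x → f x ≡ i) (λ x → f x Fin.≟ i) (λ x≈y → ≡.trans (≡.sym (f-cong x≈y)))

-- Signs and two-graphs

open import Defs using (_≈_)

agree : Bool → Sign
agree true  = Sign.+
agree false = Sign.-

fromSign : Sign → Bool
fromSign Sign.+ = true
fromSign Sign.- = false

agree-fromSign : ∀ s → agree (fromSign s) ≡ s
agree-fromSign Sign.+ = ≡.refl
agree-fromSign Sign.- = ≡.refl

ZeroTwoOrFour : ℕ → Set
ZeroTwoOrFour c = c ≡ 0 ⊎ c ≡ 2 ⊎ c ≡ 4

private
  even : ∀ {c} → ZeroTwoOrFour c → ZeroTwoOrFour c ⇔ (Sign.+ ≡ Sign.+)
  even t = mk⇔ (λ _ → ≡.refl) (λ _ → t)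

  odd : ∀ {c} → ¬ ZeroTwoOrFour c → ZeroTwoOrFour c ⇔ (Sign.- ≡ Sign.+)
  odd ¬t = mk⇔ (λ t → ⊥-elim (¬t t)) (λ ())

  ¬ZeroTwoOrFour1 : ¬ ZeroTwoOrFour 1
  ¬ZeroTwoOrFour1 (inj₁ ())
  ¬ZeroTwoOrFour1 (inj₂ (inj₁ ()))
  ¬ZeroTwoOrFour1 (inj₂ (inj₂ ()))

  ¬ZeroTwoOrFour3 : ¬ ZeroTwoOrFour 3
  ¬ZeroTwoOrFour3 (inj₁ ())
  ¬ZeroTwoOrFour3 (inj₂ (inj₁ ()))
  ¬ZeroTwoOrFour3 (inj₂ (inj₂ ()))

zeroTwoOrFour⇔agree : ∀ a b c d →
  ZeroTwoOrFour (b2n a + b2n b + b2n c + b2n d) ⇔ (agree a · agree b · agree c · agree d ≡ Sign.+)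
zeroTwoOrFour⇔agree true  true  true  true  = even (inj₂ (inj₂ ≡.refl))
zeroTwoOrFour⇔agree true  true  true  false = odd ¬ZeroTwoOrFour3
zeroTwoOrFour⇔agree true  true  false true  = odd ¬ZeroTwoOrFour3
zeroTwoOrFour⇔agree true  true  false false = even (inj₂ (inj₁ ≡.refl))
zeroTwoOrFour⇔agree true  false true  true  = odd ¬ZeroTwoOrFour3
zeroTwoOrFour⇔agree true  false true  false = even (inj₂ (inj₁ ≡.refl))
zeroTwoOrFour⇔agree true  false false true  = even (inj₂ (inj₁ ≡.refl))
zeroTwoOrFour⇔agree true  false false false = odd ¬ZeroTwoOrFour1
zeroTwoOrFour⇔agree false true  true  true  = odd ¬ZeroTwoOrFour3
zeroTwoOrFour⇔agree false true  true  false = even (inj₂ (inj₁ ≡.refl))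
zeroTwoOrFour⇔agree false true  false true  = even (inj₂ (inj₁ ≡.refl))
zeroTwoOrFour⇔agree false true  false false = odd ¬ZeroTwoOrFour1
zeroTwoOrFour⇔agree false false true  true  = even (inj₂ (inj₁ ≡.refl))
zeroTwoOrFour⇔agree false false true  false = odd ¬ZeroTwoOrFour1
zeroTwoOrFour⇔agree false false false true  = odd ¬ZeroTwoOrFour1
zeroTwoOrFour⇔agree false false false false = even (inj₁ ≡.refl)

-- s ·₃ g is g switched by the sign pattern s.
infixl 25 _·₃_
_·₃_ : T3 n → T3 n → T3 n
(s ·₃ g) x y z = s x y z · g x y z

agree₃ : (Fin n → Fin n → Fin n → Bool) → T3 n
agree₃ X x y z = agree (X x y z)

Symmetric : T3 n → Set
Symmetric s = ∀ x y z → Distinct3 x y z → s y x z ≡ s x y z × s x z y ≡ s x y z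

δ : T3 n → Fin n → Fin n → Fin n → Fin n → Sign
δ s x y z w = s x y z · s x y w · s x z w · s y z w

hSign : T3 n → Fin n → Fin n → Fin n → Fin n → Sign
hSign g x y z w = g x y z · g y x w · g z y w · g x z w

private variable
  g g′ s : T3 n
  x y z w : Fin n

hSign-cong : g ≈ g′ → Distinct4 x y z w → hSign g x y z w ≡ hSign g′ x y z w
hSign-cong {x = x} {y} {z} {w} g≈g′ (x≢y , x≢z , x≢w , y≢z , y≢w , z≢w) =
  cong₂ _·_ (cong₂ _·_ (cong₂ _·_ (g≈g′ x y z (x≢y , y≢z , x≢z)) (g≈g′ y x w (≢-sym x≢y , x≢w , y≢w)))
                       (g≈g′ z y w (≢-sym y≢z , y≢w , z≢w)))
            (g≈g′ x z w (x≢z , z≢w , x≢w))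

hSign-· : Symmetric s → Distinct4 x y z w → hSign (s ·₃ g) x y z w ≡ δ s x y z w · hSign g x y z w
hSign-· {s = s} {x = x} {y} {z} {w} {g = g} s-sym (x≢y , x≢z , x≢w , y≢z , y≢w , z≢w) = begin
  (s x y z · g x y z) · (s y x w · g y x w) · (s z y w · g z y w) · (s x z w · g x z w)
    ≡⟨ cong₂ (λ a b → (s x y z · g x y z) · (a · g y x w) · (b · g z y w) · (s x z w · g x z w))
             (proj₁ (s-sym x y w (x≢y , y≢w , x≢w))) (proj₁ (s-sym y z w (y≢z , z≢w , y≢w))) ⟩
  (s x y z · g x y z) · (s x y w · g y x w) · (s y z w · g z y w) · (s x z w · g x z w)
    ≡⟨ solve 8 (λ a b c d p q r t →
         (((a ⊕ p) ⊕ (b ⊕ q)) ⊕ (c ⊕ r)) ⊕ (d ⊕ t) ⊜ (((a ⊕ b) ⊕ d) ⊕ c) ⊕ (((p ⊕ q) ⊕ r) ⊕ t)) ≡.refl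
         (s x y z) (s x y w) (s y z w) (s x z w) (g x y z) (g y x w) (g z y w) (g x z w) ⟩
  δ s x y z w · hSign g x y z w ∎
  where open ≡.≡-Reasoning

SameH : T3 n → T3 n → Set
SameH g g′ = ∀ x y z w → Distinct4 x y z w → hSign g x y z w ≡ hSign g′ x y z w

Cocycle : T3 n → Set
Cocycle s = Symmetric s × (∀ x y z w → Distinct4 x y z w → δ s x y z w ≡ Sign.+)

≈-refl : g ≈ g
≈-refl _ _ _ _ = ≡.refl

≈-sym : g ≈ g′ → g′ ≈ g
≈-sym p x y z d = ≡.sym (p x y z d)

≈-trans : ∀ {g g′ g″ : T3 n} → g ≈ g′ → g′ ≈ g″ → g ≈ g″
≈-trans p q x y z d = ≡.trans (p x y z d) (q x y z d)

·₃-congˡ : ∀ {s s′} (g : T3 n) → s ≈ s′ → (s ·₃ g) ≈ (s′ ·₃ g)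
·₃-congˡ g p x y z d = cong (_· g x y z) (p x y z d)

·-opposite : ∀ a b → a · opposite b ≡ opposite (a · b)
·-opposite Sign.+ b = ≡.refl
·-opposite Sign.- b = ≡.refl

opposite-·-opposite : ∀ a b → opposite a · opposite b ≡ a · b
opposite-·-opposite Sign.+ Sign.+ = ≡.refl
opposite-·-opposite Sign.+ Sign.- = ≡.refl
opposite-·-opposite Sign.- Sign.+ = ≡.refl
opposite-·-opposite Sign.- Sign.- = ≡.refl

switch≈agree₃·₃ : (g : T3 n) (X : Fin n → Fin n → Fin n → Bool) → switch g X ≈ (agree₃ X ·₃ g)
switch≈agree₃·₃ g X x y z _ with X x y z
... | true  = ≡.refl
... | false = ≡.refl

isTwoGraph⇔cocycle : ∀ (X : Fin n → Fin n → Fin n → Bool) → IsTwoGraph X ⇔ (Sym3 X × Cocycle (agree₃ X))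
isTwoGraph⇔cocycle X = mk⇔
  (λ (X-sym , X-count) → X-sym , symmetric X-sym , λ x y z w d →
     Equivalence.to (zeroTwoOrFour⇔agree (X x y z) (X x y w) (X x z w) (X y z w)) (X-count x y z w d))
  (λ (X-sym , _ , δ≡+) → X-sym , λ x y z w d →
     Equivalence.from (zeroTwoOrFour⇔agree (X x y z) (X x y w) (X x z w) (X y z w)) (δ≡+ x y z w d))
  where
  symmetric : Sym3 X → Symmetric (agree₃ X)
  symmetric X-sym x y z d = cong agree (proj₁ (X-sym x y z d)) , cong agree (proj₂ (X-sym x y z d))

cocycle-resp : ∀ {s s′ : T3 n} → s ≈ s′ → Cocycle s → Cocycle s′
cocycle-resp {s = s} {s′} s≈s′ (s-sym , δs≡+) = s′-sym , λ x y z w d → ≡.trans (≡.sym (δ-cong d)) (δs≡+ x y z w d)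
  where
  s′-sym : Symmetric s′
  s′-sym x y z d@(x≢y , y≢z , x≢z) =
    ≡.trans (≡.sym (s≈s′ y x z (≢-sym x≢y , x≢z , y≢z))) (≡.trans (proj₁ (s-sym x y z d)) (s≈s′ x y z d)) ,
    ≡.trans (≡.sym (s≈s′ x z y (x≢z , ≢-sym y≢z , x≢y))) (≡.trans (proj₂ (s-sym x y z d)) (s≈s′ x y z d))
  δ-cong : Distinct4 x y z w → δ s x y z w ≡ δ s′ x y z w
  δ-cong {x} {y} {z} {w} (x≢y , x≢z , x≢w , y≢z , y≢w , z≢w) =
    cong₂ _·_ (cong₂ _·_ (cong₂ _·_ (s≈s′ x y z (x≢y , y≢z , x≢z)) (s≈s′ x y w (x≢y , y≢w , x≢w)))
                         (s≈s′ x z w (x≢z , z≢w , x≢w)))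
              (s≈s′ y z w (y≢z , z≢w , y≢w))

cocycle⇒switchEq : Cocycle s → SwitchEq g (s ·₃ g)
cocycle⇒switchEq {s = s} {g = g} (s-sym , δs≡+) =
  X , Equivalence.from (isTwoGraph⇔cocycle X) (X-sym , agree₃X-cocycle) ,
  ≈-trans (·₃-congˡ g agree₃X≈s) (≈-sym (switch≈agree₃·₃ g X))
  where
  X : Fin _ → Fin _ → Fin _ → Bool
  X x y z = fromSign (s x y z)
  agree₃X≈s : s ≈ agree₃ X
  agree₃X≈s x y z _ = ≡.sym (agree-fromSign (s x y z))
  X-sym : Sym3 X
  X-sym x y z d = cong fromSign (proj₁ (s-sym x y z d)) , cong fromSign (proj₂ (s-sym x y z d))
  agree₃X-cocycle : Cocycle (agree₃ X)
  agree₃X-cocycle = cocycle-resp agree₃X≈s (s-sym , δs≡+)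

switchEq⇒sameH : ∀ {g₀ g : T3 n} → SwitchEq g₀ g → SameH g g₀
switchEq⇒sameH {g₀ = g₀} {g} (X , X-twoGraph , g≈) x y z w d with Equivalence.to (isTwoGraph⇔cocycle X) X-twoGraph
... | _ , X-sym , δX≡+ = begin
  hSign g x y z w                    ≡⟨ hSign-cong (≈-trans g≈ (switch≈agree₃·₃ g₀ X)) d ⟩
  hSign (agree₃ X ·₃ g₀) x y z w     ≡⟨ hSign-· X-sym d ⟩
  δ (agree₃ X) x y z w · hSign g₀ x y z w ≡⟨ cong (_· hSign g₀ x y z w) (δX≡+ x y z w d) ⟩
  hSign g₀ x y z w                   ∎
  where open ≡.≡-Reasoning

·₃-tournament : Symmetric s → Is3Tournament g → Is3Tournament (s ·₃ g)
·₃-tournament {s = s} {g = g} s-sym g-alt x y z d =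
  ≡.trans (cong₂ _·_ (proj₁ (s-sym x y z d)) (proj₁ (g-alt x y z d))) (·-opposite (s x y z) (g x y z)) ,
  ≡.trans (cong₂ _·_ (proj₂ (s-sym x y z d)) (proj₂ (g-alt x y z d))) (·-opposite (s x y z) (g x y z))

ratio-·₃ : (g g₀ : T3 n) → g ≈ ((g ·₃ g₀) ·₃ g₀)
ratio-·₃ g g₀ x y z _ = ≡.sym (≡.trans (Sign.*-assoc (g x y z) (g₀ x y z) (g₀ x y z))
  (≡.trans (cong (g x y z ·_) (Sign.s*s≡+ (g₀ x y z))) (Sign.*-identityʳ (g x y z))))

ratio-cocycle : ∀ {g₀ g : T3 n} → Is3Tournament g₀ → Is3Tournament g → SameH g g₀ → Cocycle (g ·₃ g₀)
ratio-cocycle {g₀ = g₀} {g} g₀-alt g-alt g~g₀ = ratio-sym , λ x y z w d →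
  Sign.*-cancelʳ-≡ _ _ _ (≡.trans (≡.sym (hSign-· ratio-sym d))
    (≡.trans (≡.sym (hSign-cong (ratio-·₃ g g₀) d)) (g~g₀ x y z w d)))
  where
  ratio-sym : Symmetric (g ·₃ g₀)
  ratio-sym x y z d =
    ≡.trans (cong₂ _·_ (proj₁ (g-alt x y z d)) (proj₁ (g₀-alt x y z d))) (opposite-·-opposite (g x y z) (g₀ x y z)) ,
    ≡.trans (cong₂ _·_ (proj₂ (g-alt x y z d)) (proj₂ (g₀-alt x y z d))) (opposite-·-opposite (g x y z) (g₀ x y z))

cocycle⇒inClass : ∀ {g₀ s : T3 n} → Is3Tournament g₀ → Cocycle s → InClass g₀ (s ·₃ g₀)
cocycle⇒inClass g₀-alt s-cocycle = ·₃-tournament (proj₁ s-cocycle) g₀-alt , cocycle⇒switchEq s-cocycle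

inClass⇔sameH : ∀ {g₀ g : T3 n} → Is3Tournament g₀ → InClass g₀ g ⇔ (Is3Tournament g × SameH g g₀)
inClass⇔sameH {g₀ = g₀} {g} g₀-alt = mk⇔
  (λ (g-alt , g~g₀) → g-alt , switchEq⇒sameH g~g₀)
  (λ (g-alt , g~g₀) → g-alt ,
     let (X , X-twoGraph , ratio≈) = cocycle⇒switchEq (ratio-cocycle g₀-alt g-alt g~g₀)
     in X , X-twoGraph , ≈-trans (ratio-·₃ g g₀) ratio≈)

-- The size of a switching class

triangles : (Fin n → Fin n → Sign) → T3 n
triangles ε x y z = ε x y · ε y z · ε x z

-- Every edge of the 4-set occurs in exactly two of its triangles.
δ-triangles : ∀ (ε : Fin n → Fin n → Sign) x y z w → δ (triangles ε) x y z w ≡ Sign.+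
δ-triangles ε x y z w = begin
  δ (triangles ε) x y z w
    ≡⟨ solve 6 (λ a b c d e f →
         ((((a ⊕ d) ⊕ b) ⊕ ((a ⊕ e) ⊕ c)) ⊕ ((b ⊕ f) ⊕ c)) ⊕ ((d ⊕ f) ⊕ e) ⊜
         (a ⊕ a) ⊕ ((b ⊕ b) ⊕ ((c ⊕ c) ⊕ ((d ⊕ d) ⊕ ((e ⊕ e) ⊕ (f ⊕ f))))))
       ≡.refl (ε x y) (ε x z) (ε x w) (ε y z) (ε y w) (ε z w) ⟩
  ε x y ² · (ε x z ² · (ε x w ² · (ε y z ² · (ε y w ² · ε z w ²))))
    ≡⟨ cong₂ _·_ (Sign.s*s≡+ (ε x y)) (cong₂ _·_ (Sign.s*s≡+ (ε x z)) (cong₂ _·_ (Sign.s*s≡+ (ε x w))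
         (cong₂ _·_ (Sign.s*s≡+ (ε y z)) (cong₂ _·_ (Sign.s*s≡+ (ε y w)) (Sign.s*s≡+ (ε z w)))))) ⟩
  Sign.+ ∎
  where
  open ≡.≡-Reasoning
  _² : Sign → Sign
  s ² = s · s

triangles-cocycle : ∀ (ε : Fin n → Fin n → Sign) → (∀ a b → ε a b ≡ ε b a) → Cocycle (triangles ε)
triangles-cocycle ε ε-sym = triangles-sym , λ x y z w _ → δ-triangles ε x y z w
  where
  triangles-sym : Symmetric (triangles ε)
  triangles-sym x y z _ =
    ≡.trans (cong (λ a → a · ε x z · ε y z) (ε-sym y x))
      (solve 3 (λ a b c → (a ⊕ c) ⊕ b ⊜ (a ⊕ b) ⊕ c) ≡.refl (ε x y) (ε y z) (ε x z)) ,
    ≡.trans (cong (λ a → ε x z · a · ε x y) (ε-sym z y))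
      (solve 3 (λ a b c → (c ⊕ b) ⊕ a ⊜ (a ⊕ b) ⊕ c) ≡.refl (ε x y) (ε y z) (ε x z))

SignedGraph : ℕ → Set
SignedGraph = Graph (≡.setoid Sign)

sign-enumeration : Enumeration (≡.setoid Sign) 2
sign-enumeration = record
  { enum           = λ { zero → Sign.+ ; (suc zero) → Sign.- }
  ; enum-injective = λ { {zero} {zero} _ → ≡.refl ; {suc zero} {suc zero} _ → ≡.refl
                       ; {zero} {suc zero} () ; {suc zero} {zero} () }
  ; index          = λ { Sign.+ → zero ; Sign.- → suc zero }
  ; enum-index     = λ { Sign.+ → ≡.refl ; Sign.- → ≡.refl }
  }

-- A new vertex zero is joined to everything by +; the value on the diagonal is junk.
edgeSign : SignedGraph m → Fin (suc m) → Fin (suc m) → Sign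
edgeSign G zero    _       = Sign.+
edgeSign G (suc x) zero    = Sign.+
edgeSign G (suc x) (suc y) with Fin.<-cmp x y
... | tri< x<y _ _ = G x y x<y
... | tri≈ _ _ _   = Sign.+
... | tri> _ _ y<x = G y x y<x

edgeSign-sym : ∀ (G : SignedGraph m) a b → edgeSign G a b ≡ edgeSign G b a
edgeSign-sym G zero    zero    = ≡.refl
edgeSign-sym G zero    (suc y) = ≡.refl
edgeSign-sym G (suc x) zero    = ≡.refl
edgeSign-sym G (suc x) (suc y) with Fin.<-cmp x y | Fin.<-cmp y x
... | tri< _ _ _   | tri> _ _ _   = ≡.refl
... | tri≈ _ _ _   | tri≈ _ _ _   = ≡.refl
... | tri> _ _ _   | tri< _ _ _   = ≡.refl
... | tri< x<y _ _ | tri< _ _ x≮y = ⊥-elim (x≮y x<y)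
... | tri< x<y _ _ | tri≈ _ _ x≮y = ⊥-elim (x≮y x<y)
... | tri≈ _ x≡y _ | tri< _ y≢x _ = ⊥-elim (y≢x (≡.sym x≡y))
... | tri≈ _ x≡y _ | tri> _ y≢x _ = ⊥-elim (y≢x (≡.sym x≡y))
... | tri> _ _ y<x | tri≈ y≮x _ _ = ⊥-elim (y≮x y<x)
... | tri> _ _ y<x | tri> y≮x _ _ = ⊥-elim (y≮x y<x)

edgeSign-cong : ∀ {G G′ : SignedGraph m} → Setoid._≈_ (graph-setoid (≡.setoid Sign) m) G G′ →
  ∀ a b → edgeSign G a b ≡ edgeSign G′ a b
edgeSign-cong G≈G′ zero    _       = ≡.refl
edgeSign-cong G≈G′ (suc x) zero    = ≡.refl
edgeSign-cong G≈G′ (suc x) (suc y) with Fin.<-cmp x y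
... | tri< x<y _ _ = G≈G′ x y x<y
... | tri≈ _ _ _   = ≡.refl
... | tri> _ _ y<x = G≈G′ y x y<x

edgeSign-< : ∀ (G : SignedGraph m) {x y} .(x<y : x Fin.< y) → edgeSign G (suc x) (suc y) ≡ G x y x<y
edgeSign-< G {x} {y} x<y with Fin.<-cmp x y
... | tri< _ _ _   = ≡.refl
... | tri≈ x≮y _ _ = ⊥-elim-irr (x≮y x<y)
... | tri> x≮y _ _ = ⊥-elim-irr (x≮y x<y)

graph-of : T3 (suc m) → SignedGraph m
graph-of ρ x y _ = ρ zero (suc x) (suc y)

edgeSign-graph-of : ∀ {ρ : T3 (suc m)} → Symmetric ρ → ∀ {x y} → x ≢ y →
  edgeSign (graph-of ρ) (suc x) (suc y) ≡ ρ zero (suc x) (suc y)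
edgeSign-graph-of ρ-sym {x} {y} x≢y with Fin.<-cmp x y
... | tri< _ _ _   = ≡.refl
... | tri≈ _ x≡y _ = ⊥-elim (x≢y x≡y)
... | tri> _ _ _   = proj₂ (ρ-sym zero (suc x) (suc y) ((λ ()) , (λ p → x≢y (Fin.suc-injective p)) , (λ ())))

fourth-factor : ∀ a b c {d} → a · b · c · d ≡ Sign.+ → d ≡ a · b · c
fourth-factor a b c p = Sign.*-cancelˡ-≡ (a · b · c) _ _ (≡.trans p (≡.sym (Sign.s*s≡+ (a · b · c))))

cocycle≈triangles : ∀ {ρ : T3 (suc m)} → Cocycle ρ → ρ ≈ triangles (edgeSign (graph-of ρ))
cocycle≈triangles (ρ-sym , δρ≡+) zero    zero    _       (0≢0 , _ , _)   = ⊥-elim (0≢0 ≡.refl)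
cocycle≈triangles (ρ-sym , δρ≡+) zero    (suc y) zero    (_ , _ , 0≢0)   = ⊥-elim (0≢0 ≡.refl)
cocycle≈triangles (ρ-sym , δρ≡+) (suc x) zero    zero    (_ , 0≢0 , _)   = ⊥-elim (0≢0 ≡.refl)
cocycle≈triangles (ρ-sym , δρ≡+) zero    (suc y) (suc z) (_ , y≢z , _)   =
  ≡.sym (≡.trans (Sign.*-identityʳ _) (edgeSign-graph-of ρ-sym (y≢z ∘ cong suc)))
cocycle≈triangles (ρ-sym , δρ≡+) (suc x) zero    (suc z) (_ , _ , x≢z)   =
  ≡.trans (proj₁ (ρ-sym zero (suc x) (suc z) ((λ ()) , x≢z , (λ ()))))
          (≡.sym (edgeSign-graph-of ρ-sym (x≢z ∘ cong suc)))
cocycle≈triangles (ρ-sym , δρ≡+) (suc x) (suc y) zero    (x≢y , _ , _)   =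
  ≡.trans (proj₂ (ρ-sym (suc x) zero (suc y) ((λ ()) , (λ ()) , x≢y)))
    (≡.trans (proj₁ (ρ-sym zero (suc x) (suc y) ((λ ()) , x≢y , (λ ()))))
      (≡.sym (≡.trans (Sign.*-identityʳ _)
        (≡.trans (Sign.*-identityʳ _) (edgeSign-graph-of ρ-sym (x≢y ∘ cong suc))))))
cocycle≈triangles {ρ = ρ} (ρ-sym , δρ≡+) (suc x) (suc y) (suc z) (x≢y , y≢z , x≢z) = begin
  ρ (suc x) (suc y) (suc z)
    ≡⟨ fourth-factor (ρ₀ (suc x) (suc y)) (ρ₀ (suc x) (suc z)) (ρ₀ (suc y) (suc z))
         (δρ≡+ zero (suc x) (suc y) (suc z) ((λ ()) , (λ ()) , (λ ()) , x≢y , x≢z , y≢z)) ⟩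
  ρ₀ (suc x) (suc y) · ρ₀ (suc x) (suc z) · ρ₀ (suc y) (suc z)
    ≡⟨ solve 3 (λ a b c → (a ⊕ b) ⊕ c ⊜ (a ⊕ c) ⊕ b) ≡.refl
         (ρ₀ (suc x) (suc y)) (ρ₀ (suc x) (suc z)) (ρ₀ (suc y) (suc z)) ⟩
  ρ₀ (suc x) (suc y) · ρ₀ (suc y) (suc z) · ρ₀ (suc x) (suc z)
    ≡⟨ ≡.sym (cong₂ _·_ (cong₂ _·_ (edgeSign-graph-of ρ-sym (x≢y ∘ cong suc))
                                   (edgeSign-graph-of ρ-sym (y≢z ∘ cong suc)))
                        (edgeSign-graph-of ρ-sym (x≢z ∘ cong suc))) ⟩
  triangles (edgeSign (graph-of ρ)) (suc x) (suc y) (suc z) ∎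
  where
  open ≡.≡-Reasoning
  ρ₀ : Fin (suc _) → Fin (suc _) → Sign
  ρ₀ = ρ zero

triangles-cong : ∀ {ε ε′ : Fin n → Fin n → Sign} → (∀ a b → ε a b ≡ ε′ a b) → triangles ε ≈ triangles ε′
triangles-cong ε≗ε′ x y z _ = cong₂ _·_ (cong₂ _·_ (ε≗ε′ x y) (ε≗ε′ y z)) (ε≗ε′ x z)

t3-setoid : ℕ → Setoid 0ℓ 0ℓ
t3-setoid n = record
  { Carrier = T3 n ; _≈_ = _≈_
  ; isEquivalence = record { refl = ≈-refl ; sym = ≈-sym ; trans = ≈-trans } }

class-setoid : T3 n → Setoid 0ℓ 0ℓ
class-setoid {n} g₀ = subsetoid (t3-setoid n) (InClass g₀)

class-enumeration : ∀ {g₀ : T3 n} → Is3Tournament g₀ → Enumeration (class-setoid g₀) (2 ^ ((n ∸ 1) C 2))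
class-enumeration {zero} {g₀} g₀-alt = record
  { enum           = λ _ → g₀ , g₀-alt , (λ _ _ _ → true) , ((λ ()) , (λ ())) , (λ ())
  ; enum-injective = λ { {zero} {zero} _ → ≡.refl }
  ; index          = λ _ → zero
  ; enum-index     = λ _ () }
class-enumeration {suc m} {g₀} g₀-alt = transport {A = graph-setoid (≡.setoid Sign) m}
  (λ G → triangles (edgeSign G) ·₃ g₀ , cocycle⇒inClass g₀-alt (triangles-cocycle (edgeSign G) (edgeSign-sym G)))
  (λ (g , _) → graph-of (g ·₃ g₀))
  (λ G≈G′ → ·₃-congˡ g₀ (triangles-cong (edgeSign-cong G≈G′)))
  injective
  (λ (g , g-alt , g~g₀) → ≈-trans (ratio-·₃ g g₀)
     (·₃-congˡ g₀ (cocycle≈triangles (ratio-cocycle g₀-alt g-alt (switchEq⇒sameH g~g₀)))))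
  (graph-enumeration (≡.setoid Sign) sign-enumeration m)
  where
  injective : ∀ {G G′} → triangles (edgeSign G) ·₃ g₀ ≈ triangles (edgeSign G′) ·₃ g₀ →
    Setoid._≈_ (graph-setoid (≡.setoid Sign) m) G G′
  injective {G} {G′} p x y x<y = begin
    G x y x<y                                     ≡⟨ ≡.sym (edgeSign-< G x<y) ⟩
    edgeSign G (suc x) (suc y)                    ≡⟨ ≡.sym (Sign.*-identityʳ _) ⟩
    triangles (edgeSign G) zero (suc x) (suc y)   ≡⟨ Sign.*-cancelʳ-≡ _ _ _ (p zero (suc x) (suc y) distinct) ⟩
    triangles (edgeSign G′) zero (suc x) (suc y)  ≡⟨ Sign.*-identityʳ _ ⟩
    edgeSign G′ (suc x) (suc y)                   ≡⟨ edgeSign-< G′ x<y ⟩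
    G′ x y x<y                                    ∎
    where
    open ≡.≡-Reasoning
    distinct : Distinct3 zero (suc x) (suc y)
    distinct = (λ ()) , (λ x≡y → ⊥-elim-irr (Fin.<⇒≢ x<y (Fin.suc-injective x≡y))) , (λ ())

-- Permutations acting on 3-tournaments and on H(g₀)

⟨$⟩ʳ-injective : (σ : Permutation′ n) → ∀ {a b} → σ ⟨$⟩ʳ a ≡ σ ⟨$⟩ʳ b → a ≡ b
⟨$⟩ʳ-injective σ p = ≡.trans (≡.sym (inverseˡ σ)) (≡.trans (cong (σ ⟨$⟩ˡ_) p) (inverseˡ σ))

⟨$⟩ˡ-injective : (σ : Permutation′ n) → ∀ {a b} → σ ⟨$⟩ˡ a ≡ σ ⟨$⟩ˡ b → a ≡ b
⟨$⟩ˡ-injective σ = ⟨$⟩ʳ-injective (flip σ)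

distinct3-map : (f : Fin n → Fin n) → Injective _≡_ _≡_ f → Distinct3 x y z → Distinct3 (f x) (f y) (f z)
distinct3-map f f-inj (x≢y , y≢z , x≢z) = x≢y ∘ f-inj , y≢z ∘ f-inj , x≢z ∘ f-inj

distinct4-map : (f : Fin n → Fin n) → Injective _≡_ _≡_ f → Distinct4 x y z w → Distinct4 (f x) (f y) (f z) (f w)
distinct4-map f f-inj (x≢y , x≢z , x≢w , y≢z , y≢w , z≢w) =
  x≢y ∘ f-inj , x≢z ∘ f-inj , x≢w ∘ f-inj , y≢z ∘ f-inj , y≢w ∘ f-inj , z≢w ∘ f-inj

act-tournament : (σ : Permutation′ n) → Is3Tournament g → Is3Tournament (act σ g)
act-tournament σ g-alt x y z d = g-alt _ _ _ (distinct3-map (σ ⟨$⟩ˡ_) (⟨$⟩ˡ-injective σ) d)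

act-cong : (σ : Permutation′ n) → g ≈ g′ → act σ g ≈ act σ g′
act-cong σ g≈g′ x y z d = g≈g′ _ _ _ (distinct3-map (σ ⟨$⟩ˡ_) (⟨$⟩ˡ-injective σ) d)

act-≈ₚ : ∀ (g : T3 n) σ τ → σ ≈ₚ τ → act σ g ≈ act τ g
act-≈ₚ g σ τ σ≈τ x y z _ = cong₃ (σˡ≡τˡ x) (σˡ≡τˡ y) (σˡ≡τˡ z)
  where
  σˡ≡τˡ : ∀ a → σ ⟨$⟩ˡ a ≡ τ ⟨$⟩ˡ a
  σˡ≡τˡ a = ⟨$⟩ʳ-injective τ (≡.trans (≡.sym (σ≈τ (σ ⟨$⟩ˡ a))) (≡.trans (inverseʳ σ) (≡.sym (inverseʳ τ))))
  cong₃ : ∀ {a a′ b b′ c c′} → a ≡ a′ → b ≡ b′ → c ≡ c′ → g a b c ≡ g a′ b′ c′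
  cong₃ ≡.refl ≡.refl ≡.refl = ≡.refl

act-flip-act : (σ : Permutation′ n) (g : T3 n) → act (flip σ) (act σ g) ≈ g
act-flip-act σ g x y z _ rewrite inverseˡ σ {x} | inverseˡ σ {y} | inverseˡ σ {z} = ≡.refl

act-act-flip : (σ : Permutation′ n) (g : T3 n) → act σ (act (flip σ) g) ≈ g
act-act-flip σ = act-flip-act (flip σ)

act-≈-act⇔inAut : ∀ (σ τ : Permutation′ n) (g : T3 n) → (act σ g ≈ act τ g) ⇔ InAut g (σ ⁻¹· τ)
act-≈-act⇔inAut σ τ g = mk⇔
  (λ σg≈τg → ≈-trans (act-cong (flip σ) (≈-sym σg≈τg)) (act-flip-act σ g))
  (λ aut → ≈-sym (≈-trans (≈-sym (act-act-flip σ (act τ g))) (act-cong σ aut)))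

iso-sym : Iso g g′ → Iso g′ g
iso-sym {g = g} (σ , g′≈σg) = flip σ , ≈-sym (≈-trans (act-cong (flip σ) g′≈σg) (act-flip-act σ g))

iso-trans : ∀ {g g′ g″ : T3 n} → Iso g g′ → Iso g′ g″ → Iso g g″
iso-trans (σ , g′≈σg) (τ , g″≈τg′) = σ ∘ₚ τ , ≈-trans g″≈τg′ (act-cong τ g′≈σg)

iso-respʳ : ∀ {g g′ g″ : T3 n} → g′ ≈ g″ → Iso g g′ → Iso g g″
iso-respʳ g′≈g″ (σ , g′≈σg) = σ , ≈-trans (≈-sym g′≈g″) g′≈σg


perm-setoid : ℕ → Setoid 0ℓ 0ℓ
perm-setoid n = record
  { Carrier = Permutation′ n ; _≈_ = _≈ₚ_
  ; isEquivalence = record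
    { refl = λ _ → ≡.refl ; sym = λ p x → ≡.sym (p x) ; trans = λ p q x → ≡.trans (p x) (q x) } }

hasCard⇒enumeration : ∀ {P : Permutation′ n → Set} {m} → HasCard P m → Enumeration (subsetoid (perm-setoid n) P) m
hasCard⇒enumeration (e , e-in , e-injective , e-onto) = record
  { enum           = λ i → e i , e-in i
  ; enum-injective = e-injective _ _
  ; index          = λ (σ , σ-in) → proj₁ (e-onto σ σ-in)
  ; enum-index     = λ (σ , σ-in) → proj₂ (e-onto σ σ-in)
  }

quadruple-setoid : ℕ → Setoid 0ℓ 0ℓ
quadruple-setoid n = V ×ₛ (V ×ₛ (V ×ₛ V)) where V = ≡.setoid (Fin n)

quadruple-enumeration : ∀ n → Enumeration (quadruple-setoid n) (n * (n * (n * n)))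
quadruple-enumeration n =
  fin-enumeration n ×-enumeration (fin-enumeration n ×-enumeration (fin-enumeration n ×-enumeration fin-enumeration n))

IsEdge : T3 n → Setoid.Carrier (quadruple-setoid n) → Set
IsEdge g (x , y , z , w) = Distinct4 x y z w × H g x y z w

isEdge? : ∀ (g : T3 n) q → Dec (IsEdge g q)
isEdge? g (x , y , z , w) =
  (¬? (x Fin.≟ y) ×-dec ¬? (x Fin.≟ z) ×-dec ¬? (x Fin.≟ w) ×-dec
   ¬? (y Fin.≟ z) ×-dec ¬? (y Fin.≟ w) ×-dec ¬? (z Fin.≟ w))
  ×-dec (hSign g x y z w Sign.≟ Sign.+)

module _ {g₀ : T3 n} (σ : Permutation′ n) (σ-aut : InAutH g₀ σ) where
  private
    Q : Setoid 0ℓ 0ℓ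
    Q = quadruple-setoid n
    open Setoid Q using () renaming (_≈_ to _≈Q_)

    Edge : Set
    Edge = Σ (Setoid.Carrier Q) (IsEdge g₀)

    edges : Enumeration (subsetoid Q (IsEdge g₀)) (count (λ j → ⌊ isEdge? g₀ (enum (quadruple-enumeration n) j) ⌋))
    edges = filter-enumeration (quadruple-enumeration n) (IsEdge g₀) (isEdge? g₀)
      (λ { (≡.refl , ≡.refl , ≡.refl , ≡.refl) e → e })

    σ-on-edges : Edge → Edge
    σ-on-edges ((x , y , z , w) , xyzw-distinct , xyzw-edge) =
      (σ ⟨$⟩ʳ x , σ ⟨$⟩ʳ y , σ ⟨$⟩ʳ z , σ ⟨$⟩ʳ w) ,
      distinct4-map (σ ⟨$⟩ʳ_) (⟨$⟩ʳ-injective σ) xyzw-distinct , σ-aut x y z w xyzw-distinct xyzw-edge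

    σ-cong : ∀ {e e′ : Edge} → proj₁ e ≈Q proj₁ e′ → proj₁ (σ-on-edges e) ≈Q proj₁ (σ-on-edges e′)
    σ-cong (≡.refl , ≡.refl , ≡.refl , ≡.refl) = ≡.refl , ≡.refl , ≡.refl , ≡.refl

    σ-injective : ∀ {e e′ : Edge} → proj₁ (σ-on-edges e) ≈Q proj₁ (σ-on-edges e′) → proj₁ e ≈Q proj₁ e′
    σ-injective (p₁ , p₂ , p₃ , p₄) =
      ⟨$⟩ʳ-injective σ p₁ , ⟨$⟩ʳ-injective σ p₂ , ⟨$⟩ʳ-injective σ p₃ , ⟨$⟩ʳ-injective σ p₄

  -- σ permutes the finitely many edges of H(g₀) injectively, hence onto; so σ⁻¹ maps edges to edges.
  inAutH-flip : InAutH g₀ (flip σ)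
  inAutH-flip a b c d abcd-distinct abcd-edge =
    let (((x , y , z , w) , _ , xyzw-edge) , σx≡a , σy≡b , σz≡c , σw≡d) =
          injective⇒surjective edges σ-on-edges (λ {e} {e′} → σ-cong {e} {e′}) (λ {e} {e′} → σ-injective {e} {e′})
            ((a , b , c , d) , abcd-distinct , abcd-edge)
    in H-cong (σ⁻¹ σx≡a) (σ⁻¹ σy≡b) (σ⁻¹ σz≡c) (σ⁻¹ σw≡d) xyzw-edge
    where
    σ⁻¹ : ∀ {x a} → σ ⟨$⟩ʳ x ≡ a → x ≡ σ ⟨$⟩ˡ a
    σ⁻¹ ≡.refl = ≡.sym (inverseˡ σ)
    H-cong : ∀ {x x′ y y′ z z′ w w′} → x ≡ x′ → y ≡ y′ → z ≡ z′ → w ≡ w′ → H g₀ x y z w → H g₀ x′ y′ z′ w′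
    H-cong ≡.refl ≡.refl ≡.refl ≡.refl h = h

signs-equal : ∀ a b → (a ≡ Sign.+ → b ≡ Sign.+) → (b ≡ Sign.+ → a ≡ Sign.+) → a ≡ b
signs-equal Sign.+ Sign.+ _ _ = ≡.refl
signs-equal Sign.- Sign.- _ _ = ≡.refl
signs-equal Sign.+ Sign.- a⇒b _ = ≡.sym (a⇒b ≡.refl)
signs-equal Sign.- Sign.+ _ b⇒a = b⇒a ≡.refl

hSign-act-⟨$⟩ʳ : ∀ (σ : Permutation′ n) (g : T3 n) x y z w →
  hSign (act σ g) (σ ⟨$⟩ʳ x) (σ ⟨$⟩ʳ y) (σ ⟨$⟩ʳ z) (σ ⟨$⟩ʳ w) ≡ hSign g x y z w
hSign-act-⟨$⟩ʳ σ g x y z w rewrite inverseˡ σ {x} | inverseˡ σ {y} | inverseˡ σ {z} | inverseˡ σ {w} = ≡.refl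

inAutH⇒sameH : ∀ {g₀ : T3 n} (σ : Permutation′ n) → InAutH g₀ σ → SameH (act σ g₀) g₀
inAutH⇒sameH {g₀ = g₀} σ σ-aut x y z w d = signs-equal _ _
  (λ h → ≡.trans (≡.sym (hSign-act-⟨$⟩ʳ (flip σ) g₀ x y z w))
     (σ-aut _ _ _ _ (distinct4-map (σ ⟨$⟩ˡ_) (⟨$⟩ˡ-injective σ) d) h))
  (inAutH-flip {g₀ = g₀} σ σ-aut x y z w d)

act-inClass : ∀ {g₀ g : T3 n} → Is3Tournament g₀ → (σ : Permutation′ n) → InAutH g₀ σ →
  InClass g₀ g → InClass g₀ (act σ g)
act-inClass {g₀ = g₀} {g} g₀-alt σ σ-aut g-in with Equivalence.to (inClass⇔sameH {g = g} g₀-alt) g-in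
... | g-alt , g~g₀ = Equivalence.from (inClass⇔sameH {g = act σ g} g₀-alt) (act-tournament σ g-alt ,
  λ x y z w d → ≡.trans (g~g₀ _ _ _ _ (distinct4-map (σ ⟨$⟩ˡ_) (⟨$⟩ˡ-injective σ) d))
                        (inAutH⇒sameH {g₀ = g₀} σ σ-aut x y z w d))

iso-inAutH : ∀ {g₀ g g′ : T3 n} → Is3Tournament g₀ → (σ : Permutation′ n) → InClass g₀ g → InClass g₀ g′ →
  g′ ≈ act σ g → InAutH g₀ σ
iso-inAutH {g₀ = g₀} {g} {g′} g₀-alt σ g-in g′-in g′≈σg x y z w d edge =
  begin
    hSign g₀ (σ ⟨$⟩ʳ x) (σ ⟨$⟩ʳ y) (σ ⟨$⟩ʳ z) (σ ⟨$⟩ʳ w)       ≡⟨ ≡.sym (g′~g₀ _ _ _ _ σd) ⟩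
    hSign g′ (σ ⟨$⟩ʳ x) (σ ⟨$⟩ʳ y) (σ ⟨$⟩ʳ z) (σ ⟨$⟩ʳ w)       ≡⟨ hSign-cong g′≈σg σd ⟩
    hSign (act σ g) (σ ⟨$⟩ʳ x) (σ ⟨$⟩ʳ y) (σ ⟨$⟩ʳ z) (σ ⟨$⟩ʳ w) ≡⟨ hSign-act-⟨$⟩ʳ σ g x y z w ⟩
    hSign g x y z w                                          ≡⟨ g~g₀ x y z w d ⟩
    hSign g₀ x y z w                                         ≡⟨ edge ⟩
    Sign.+                                                   ∎
  where
  open ≡.≡-Reasoning
  σd : Distinct4 (σ ⟨$⟩ʳ x) (σ ⟨$⟩ʳ y) (σ ⟨$⟩ʳ z) (σ ⟨$⟩ʳ w)
  σd = distinct4-map (σ ⟨$⟩ʳ_) (⟨$⟩ʳ-injective σ) d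
  g~g₀ : SameH g g₀
  g~g₀ = proj₂ (Equivalence.to (inClass⇔sameH {g = g} g₀-alt) g-in)
  g′~g₀ : SameH g′ g₀
  g′~g₀ = proj₂ (Equivalence.to (inClass⇔sameH {g = g′} g₀-alt) g′-in)

-- Orbits and stabilizers

autH-setoid : T3 n → Setoid 0ℓ 0ℓ
autH-setoid {n} g₀ = subsetoid (perm-setoid n) (InAutH g₀)

aut-setoid : T3 n → Setoid 0ℓ 0ℓ
aut-setoid {n} g = subsetoid (perm-setoid n) (InAut g)

iso-class-setoid : T3 n → T3 n → Setoid 0ℓ 0ℓ
iso-class-setoid g₀ g = subsetoid (class-setoid g₀) (λ h → Iso g (proj₁ h))

-- Aut(H(g₀)) acts transitively on the isomorphism class of g within the switching class,
-- with stabiliser Aut(g).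
orbit-stabilizer : ∀ {g₀ g : T3 n} {c o a} → Is3Tournament g₀ → InClass g₀ g →
  Enumeration (autH-setoid g₀) c → Enumeration (iso-class-setoid g₀ g) o → Enumeration (aut-setoid g) a →
  c ≡ o * a
orbit-stabilizer {n} {g₀} {g} {o = o} {a} g₀-alt g-in EH EO EA =
  ≡.trans (fibre-sizes EH orbit (λ {σ-in} {τ-in} → orbit-cong {σ-in} {τ-in}) (λ _ → a) coset) (sum-const o a)
  where
  orbit-point : Σ (Permutation′ n) (InAutH g₀) → Setoid.Carrier (iso-class-setoid g₀ g)
  orbit-point (σ , σ-aut) = (act σ g , act-inClass {g = g} g₀-alt σ σ-aut g-in) , σ , ≈-refl

  orbit : Σ (Permutation′ n) (InAutH g₀) → Fin o
  orbit σ-in = index EO (orbit-point σ-in)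

  orbit-cong : ∀ {σ-in τ-in} → proj₁ σ-in ≈ₚ proj₁ τ-in → orbit σ-in ≡ orbit τ-in
  orbit-cong {σ-in} {τ-in} σ≈τ = index-cong EO (act-≈ₚ g (proj₁ σ-in) (proj₁ τ-in) σ≈τ)

  orbit≡⇔ : ∀ σ-in j → (orbit σ-in ≡ j) ⇔ (act (proj₁ σ-in) g ≈ proj₁ (proj₁ (enum EO j)))
  orbit≡⇔ σ-in j = mk⇔
    (λ { ≡.refl → enum-index EO (orbit-point σ-in) })
    (λ σg≈hⱼ → enum-injective EO (≈-trans (≈-sym (enum-index EO (orbit-point σ-in))) σg≈hⱼ))

  coset : ∀ j → Enumeration (subsetoid (autH-setoid g₀) (λ σ-in → orbit σ-in ≡ j)) a
  coset j = transport {A = aut-setoid g} {B = subsetoid (autH-setoid g₀) (λ σ-in → orbit σ-in ≡ j)}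
    shift unshift
    (λ ρ≈ρ′ x → cong (τⱼ ⟨$⟩ʳ_) (ρ≈ρ′ x))
    (λ ρτ≈ρ′τ x → ⟨$⟩ʳ-injective τⱼ (ρτ≈ρ′τ x))
    (λ _ _ → ≡.sym (inverseʳ τⱼ))
    EA
    where
    hⱼ : T3 n
    hⱼ = proj₁ (proj₁ (enum EO j))
    hⱼ-in : InClass g₀ hⱼ
    hⱼ-in = proj₂ (proj₁ (enum EO j))
    τⱼ : Permutation′ n
    τⱼ = proj₁ (proj₂ (enum EO j))
    hⱼ≈τg : hⱼ ≈ act τⱼ g
    hⱼ≈τg = proj₂ (proj₂ (enum EO j))
    hⱼ≈ρτg : ∀ ρ → InAut g ρ → hⱼ ≈ act (ρ ∘ₚ τⱼ) g
    hⱼ≈ρτg ρ ρ-aut = ≈-trans hⱼ≈τg (act-cong τⱼ (≈-sym ρ-aut))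
    shift : Σ (Permutation′ n) (InAut g) → Σ (Σ (Permutation′ n) (InAutH g₀)) (λ σ-in → orbit σ-in ≡ j)
    shift (ρ , ρ-aut) = σ-in , Equivalence.from (orbit≡⇔ σ-in j) (≈-sym (hⱼ≈ρτg ρ ρ-aut))
      where
      σ-in : Σ (Permutation′ n) (InAutH g₀)
      σ-in = ρ ∘ₚ τⱼ , iso-inAutH {g = g} {g′ = hⱼ} g₀-alt (ρ ∘ₚ τⱼ) g-in hⱼ-in (hⱼ≈ρτg ρ ρ-aut)
    unshift : Σ (Σ (Permutation′ n) (InAutH g₀)) (λ σ-in → orbit σ-in ≡ j) → Σ (Permutation′ n) (InAut g)
    unshift ((σ , σ-aut) , orbit≡j) = τⱼ ⁻¹· σ , Equivalence.to (act-≈-act⇔inAut τⱼ σ g)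
      (≈-trans (≈-sym hⱼ≈τg) (≈-sym (Equivalence.to (orbit≡⇔ (σ , σ-aut) j) orbit≡j)))

-- Rational arithmetic

fromℚᵘ-homo-+ : ∀ p q → fromℚᵘ p +ℚ fromℚᵘ q ≡ fromℚᵘ (p ℚᵘ.+ q)
fromℚᵘ-homo-+ p q = ℚ.toℚᵘ-injective (ℚᵘ.≃-trans (ℚ.toℚᵘ-homo-+ (fromℚᵘ p) (fromℚᵘ q))
  (ℚᵘ.≃-trans (ℚᵘ.+-cong (ℚ.toℚᵘ-fromℚᵘ p) (ℚ.toℚᵘ-fromℚᵘ q)) (ℚᵘ.≃-sym (ℚ.toℚᵘ-fromℚᵘ (p ℚᵘ.+ q)))))

fromℚᵘ-homo-* : ∀ p q → fromℚᵘ p *ℚ fromℚᵘ q ≡ fromℚᵘ (p ℚᵘ.* q)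
fromℚᵘ-homo-* p q = ℚ.toℚᵘ-injective (ℚᵘ.≃-trans (ℚ.toℚᵘ-homo-* (fromℚᵘ p) (fromℚᵘ q))
  (ℚᵘ.≃-trans (ℚᵘ.*-cong (ℚ.toℚᵘ-fromℚᵘ p) (ℚ.toℚᵘ-fromℚᵘ q)) (ℚᵘ.≃-sym (ℚ.toℚᵘ-fromℚᵘ (p ℚᵘ.* q)))))

/1-homo-+ : ∀ a b → (+ (a + b)) / 1 ≡ (+ a) / 1 +ℚ (+ b) / 1
/1-homo-+ a b = ≡.sym (≡.trans (fromℚᵘ-homo-+ (mkℚᵘ (+ a) 0) (mkℚᵘ (+ b) 0))
  (ℚ.fromℚᵘ-cong {mkℚᵘ (+ a) 0 ℚᵘ.+ mkℚᵘ (+ b) 0} {mkℚᵘ (+ (a + b)) 0} (*≡* eq)))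
  where
  eq : ((+ a) ℤ.* (+ 1) ℤ.+ (+ b) ℤ.* (+ 1)) ℤ.* (+ 1) ≡ (+ (a + b)) ℤ.* (+ 1)
  eq = ≡.trans (ℤ.*-identityʳ _) (≡.trans (cong₂ ℤ._+_ (ℤ.*-identityʳ (+ a)) (ℤ.*-identityʳ (+ b)))
         (≡.trans (≡.sym (ℤ.pos-+ a b)) (≡.sym (ℤ.*-identityʳ _))))

recip-of-product : ∀ o a c → suc c ≡ o * a → recipℕ a ≡ ((+ o) / 1) *ℚ recipℕ (suc c)
recip-of-product o zero    c c≡o*0 = ⊥-elim (ℕ.1+n≢0 (≡.trans c≡o*0 (ℕ.*-zeroʳ o)))
recip-of-product o (suc a) c c≡o*a = ≡.sym (≡.trans (fromℚᵘ-homo-* (mkℚᵘ (+ o) 0) (mkℚᵘ (+ 1) c))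
  (ℚ.fromℚᵘ-cong {mkℚᵘ (+ o) 0 ℚᵘ.* mkℚᵘ (+ 1) c} {mkℚᵘ (+ 1) a} (*≡* eq)))
  where
  eq : ((+ o) ℤ.* (+ 1)) ℤ.* (+ suc a) ≡ (+ 1) ℤ.* (+ suc (c + 0))
  eq = ≡.trans (cong (ℤ._* (+ suc a)) (ℤ.*-identityʳ (+ o)))
         (≡.trans (≡.sym (ℤ.pos-* o (suc a)))
           (≡.trans (cong +_ (≡.trans (≡.sym c≡o*a) (cong suc (≡.sym (ℕ.+-identityʳ c)))))
             (≡.sym (ℤ.*-identityˡ _))))

sumℚ-/1-* : ∀ {k} (f : Fin k → ℕ) r → sumℚ (λ i → ((+ f i) / 1) *ℚ r) ≡ ((+ sum f) / 1) *ℚ r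
sumℚ-/1-* {zero}  f r = ≡.sym (ℚ.*-zeroˡ r)
sumℚ-/1-* {suc k} f r = begin
  ((+ f zero) / 1) *ℚ r +ℚ sumℚ (λ i → ((+ f (suc i)) / 1) *ℚ r)
    ≡⟨ cong (((+ f zero) / 1) *ℚ r +ℚ_) (sumℚ-/1-* (λ i → f (suc i)) r) ⟩
  ((+ f zero) / 1) *ℚ r +ℚ ((+ sum (λ i → f (suc i))) / 1) *ℚ r
    ≡⟨ ≡.sym (ℚ.*-distribʳ-+ r ((+ f zero) / 1) ((+ sum (λ i → f (suc i))) / 1)) ⟩
  (((+ f zero) / 1) +ℚ ((+ sum (λ i → f (suc i))) / 1)) *ℚ r
    ≡⟨ cong (_*ℚ r) (≡.sym (/1-homo-+ (f zero) (sum (λ i → f (suc i))))) ⟩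
  ((+ sum f) / 1) *ℚ r ∎
  where open ≡.≡-Reasoning

mass-formula : ∀ {k} N c (o a : Fin k → ℕ) → Fin c → N ≡ sum o → (∀ i → c ≡ o i * a i) →
  sumℚ (λ i → recipℕ (a i)) ≡ ((+ N) / 1) *ℚ recipℕ c
mass-formula N (suc c) o a _ N≡∑o c≡oa = begin
  sumℚ (λ i → recipℕ (a i))                      ≡⟨ sumℚ-cong (λ i → recip-of-product (o i) (a i) c (c≡oa i)) ⟩
  sumℚ (λ i → ((+ o i) / 1) *ℚ recipℕ (suc c))  ≡⟨ sumℚ-/1-* o (recipℕ (suc c)) ⟩
  ((+ sum o) / 1) *ℚ recipℕ (suc c)             ≡⟨ cong (λ m → ((+ m) / 1) *ℚ recipℕ (suc c)) (≡.sym N≡∑o) ⟩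
  ((+ N) / 1) *ℚ recipℕ (suc c)                 ∎
  where
  open ≡.≡-Reasoning
  sumℚ-cong : ∀ {k} {f g : Fin k → ℚ} → (∀ i → f i ≡ g i) → sumℚ f ≡ sumℚ g
  sumℚ-cong {zero}  f≗g = ≡.refl
  sumℚ-cong {suc k} f≗g = cong₂ _+ℚ_ (f≗g zero) (sumℚ-cong (λ i → f≗g (suc i)))

iso-class-sizes : ∀ {g₀ : T3 n} → Is3Tournament g₀ → (reps : Fin k → T3 n) →
  (∀ i j → Iso (reps i) (reps j) → i ≡ j) → (∀ g → InClass g₀ g → ∃ λ i → Iso (reps i) g) →
  Σ (Fin k → ℕ) λ o → (2 ^ ((n ∸ 1) C 2) ≡ sum o) × (∀ i → Enumeration (iso-class-setoid g₀ (reps i)) (o i))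
iso-class-sizes {n} {k} {g₀} g₀-alt reps reps-distinct reps-cover =
  o , fibre-sizes EC isoType isoType-cong o fibre , λ i → transport
    (λ (h , isoType≡i) → h , subst (λ j → Iso (reps j) (proj₁ h)) isoType≡i (proj₂ (reps-cover _ (proj₂ h))))
    (λ (h , iso) → h , isoType-unique h iso)
    (λ h≈h′ → h≈h′) (λ h≈h′ → h≈h′) (λ _ → ≈-refl) (fibre i)
  where
  EC : Enumeration (class-setoid g₀) (2 ^ ((n ∸ 1) C 2))
  EC = class-enumeration g₀-alt
  isoType : Setoid.Carrier (class-setoid g₀) → Fin k
  isoType (g , g-in) = proj₁ (reps-cover g g-in)
  isoType-unique : ∀ h {i} → Iso (reps i) (proj₁ h) → isoType h ≡ i
  isoType-unique (g , g-in) {i} iso = reps-distinct _ _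
    (iso-trans {g = reps (isoType (g , g-in))} {g′ = g} (proj₂ (reps-cover g g-in))
               (iso-sym {g = reps i} {g′ = g} iso))
  isoType-cong : ∀ {h h′} → proj₁ h ≈ proj₁ h′ → isoType h ≡ isoType h′
  isoType-cong {h} {h′} h≈h′ =
    ≡.sym (isoType-unique h′ (iso-respʳ {g = reps (isoType h)} h≈h′ (proj₂ (reps-cover (proj₁ h) (proj₂ h)))))
  o : Fin k → ℕ
  o i = count (λ j → ⌊ isoType (enum EC j) Fin.≟ i ⌋)
  fibre : ∀ i → Enumeration (subsetoid (class-setoid g₀) (λ h → isoType h ≡ i)) (o i)
  fibre i = filter-enumeration EC (λ h → isoType h ≡ i) (λ h → isoType h Fin.≟ i)
    (λ h≈h′ → ≡.trans (≡.sym (isoType-cong h≈h′)))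

coset-correspondence : ∀ {g₀ gᵢ : T3 n} → Is3Tournament g₀ → InClass g₀ gᵢ →
  Σ (Permutation′ n → T3 n) λ f →
      (∀ σ → InAutH g₀ σ → InClass g₀ (f σ) × Iso gᵢ (f σ))
    × (∀ σ τ → InAutH g₀ σ → InAutH g₀ τ → (f σ ≈ f τ) ⇔ InAut gᵢ (σ ⁻¹· τ))
    × (∀ g → InClass g₀ g → Iso gᵢ g → ∃ λ σ → InAutH g₀ σ × (f σ ≈ g))
coset-correspondence {gᵢ = gᵢ} g₀-alt gᵢ-in = (λ σ → act σ gᵢ) ,
  (λ σ σ-aut → act-inClass {g = gᵢ} g₀-alt σ σ-aut gᵢ-in , σ , ≈-refl) ,
  (λ σ τ _ _ → act-≈-act⇔inAut σ τ gᵢ) ,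
  (λ g g-in (σ , g≈σgᵢ) → σ , iso-inAutH {g = gᵢ} {g′ = g} g₀-alt σ gᵢ-in g-in g≈σgᵢ , ≈-sym g≈σgᵢ)

lemma6p5 : (n : ℕ) (g₀ : T3 n) → Is3Tournament g₀ →
    (k : ℕ) (reps : Fin k → T3 n) →
    (∀ i → InClass g₀ (reps i)) →
    (∀ i j → Iso (reps i) (reps j) → i ≡ j) →
    (∀ g → InClass g₀ g → ∃ λ i → Iso (reps i) g) →
    ((i : Fin k) → Σ (Permutation′ n → T3 n) λ f →
        (∀ σ → InAutH g₀ σ → InClass g₀ (f σ) × Iso (reps i) (f σ))
      × (∀ σ τ → InAutH g₀ σ → InAutH g₀ τ → (f σ ≈ f τ) ⇔ InAut (reps i) (σ ⁻¹· τ))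
      × (∀ g → InClass g₀ g → Iso (reps i) g → ∃ λ σ → InAutH g₀ σ × (f σ ≈ g)))
    × ((a : Fin k → ℕ) (c : ℕ) → (∀ i → HasCard (InAut (reps i)) (a i)) →
        HasCard (InAutH g₀) c →
        sumℚ (λ i → recipℕ (a i)) ≡ ((+ (2 ^ ((n ∸ 1) C 2))) / 1) *ℚ recipℕ c)
lemma6p5 n g₀ g₀-alt k reps reps-in reps-distinct reps-cover =
  (λ i → coset-correspondence g₀-alt (reps-in i)) ,
  λ a c aut-sizes autH-size →
    let (o , N≡∑o , orbits) = iso-class-sizes g₀-alt reps reps-distinct reps-cover
        EH = hasCard⇒enumeration autH-size
    in mass-formula _ c o a (index EH (idₚ , λ _ _ _ _ _ e → e)) N≡∑o
         (λ i → orbit-stabilizer g₀-alt (reps-in i) EH (orbits i) (hasCard⇒enumeration (aut-sizes i)))
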